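{- Let $m,u$ be positive integers, $\alpha=m/\gcd(m,u)$, $\beta=\gcd(m,u)$, and $\lambda_m=e^{2\pi i/m}$. Then $$F_m(1,\lambda_m^u,z)=\sum_{j\ge 0}\binom{\beta-1}{\lfloor j/\alpha\rfloor}(-1)^{\lfloor j/\alpha\rfloor+j}z^j.$$
   Context: For $m\ge2$, $F_m(x,y,z)=\prod_{j=1}^{m-1}(x+zy^j)$, and by convention $F_1(x,y,z)=1$. $\binom{a}{b}=0$ if $b<0$ or $b>a$ (so the sum is finite). -}

module Defs where

open import Level using (Level; _⊔_)
open import Algebra.Bundles using (CommutativeRing)
open import Data.Nat as ℕ using (ℕ; zero; suc; _≤_; _<_)
open import Data.Nat.DivMod using (_/_)
open import Data.Nat.Combinatorics using (_C_)
open import Data.Nat.GCD using (gcd)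
open import Data.List using (List; []; _∷_)
open import Data.Product using (_×_)
open import Data.Sum using (_⊎_)
open import Relation.Nullary using (¬_)

module _ {c ℓ : Level} (R : CommutativeRing c ℓ) where
  open CommutativeRing R

  pow : Carrier → ℕ → Carrier
  pow x zero    = 1#
  pow x (suc n) = x * pow x n

  natCast : ℕ → Carrier
  natCast zero    = 0#
  natCast (suc n) = 1# + natCast n

  signPow : ℕ → Carrier
  signPow n = pow (- 1#) n

  IsIntegralDomain : Set (c ⊔ ℓ)
  IsIntegralDomain = ¬ (1# ≈ 0#) × (∀ a b → a * b ≈ 0# → (a ≈ 0#) ⊎ (b ≈ 0#))

  IsPrimitiveRoot : Carrier → ℕ → Set ℓ
  IsPrimitiveRoot lam m = (pow lam m ≈ 1#) × (∀ k → 0 < k → k < m → ¬ (pow lam k ≈ 1#))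

  -- Polynomials in z over R as coefficient lists (constant term first).
  Poly : Set c
  Poly = List Carrier

  coeff : Poly → ℕ → Carrier
  coeff []       _       = 0#
  coeff (a ∷ p)  zero    = a
  coeff (a ∷ p)  (suc j) = coeff p j

  -- multiply a polynomial by the linear factor (x + c z)
  mulLin : Carrier → Carrier → Poly → Poly
  mulLin x c []      = []
  mulLin x c (a ∷ p) = (x * a) ∷ go a p
    where
      go : Carrier → Poly → Poly
      go prev []      = (c * prev) ∷ []
      go prev (b ∷ q) = (x * b + c * prev) ∷ go b q

  prodFrom : Carrier → Carrier → ℕ → ℕ → Poly
  prodFrom x y k zero    = 1# ∷ []
  prodFrom x y k (suc n) = mulLin x (pow y k) (prodFrom x y (suc k) n)

  -- F_m(x,y,z) = ∏_{j=1}^{m-1} (x + z y^j) as a polynomial in z  (F_1 = 1, F_0 = 1 too)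
  F : ℕ → Carrier → Carrier → Poly
  F m x y = prodFrom x y 1 (m ℕ.∸ 1)

module Submission where

-- Write α = a+1, β = b+1 and ζ = λ^u.
-- PrimitiveRootProducts connects the two: the full cycle ∏_{i<α} (1 + ζ^i z) is
-- invariant under z ↦ ζz, so in an integral domain its middle coefficients
-- vanish; hence the cofactor ∏_{0<i<α} (1 + ζ^i z) is Σ_{j<α} (-z)^j and the
-- cycle is 1 - (-z)^α.  As m - 1 = a + αb, periodicity splits F_m into b full
-- cycles times the cofactor, i.e. F_m = (1 - (-z)^α)^b Σ_{j<α} (-z)^j.

open import Defs
open import Level using (Level)
open import Algebra.Bundles using (CommutativeRing)
import Data.Nat as ℕ
open ℕ using (ℕ; zero; suc; _<_; _≤_; z≤n; s≤s; NonZero)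
import Data.Nat.Properties as ℕₚ
open import Data.Nat.DivMod using (_/_; _%_; m≡m%n+[m/n]*n; m%n<n; m<n⇒m/n≡0; m/n≡1+[m∸n]/n; m/n*n≡m)
open import Data.Nat.Divisibility using (_∣_; m%n≡0⇒n∣m; *-cancelʳ-∣; ∣⇒≤)
open import Data.Nat.Combinatorics using (_C_; nCk+nC[k+1]≡[n+1]C[k+1])
open import Data.Nat.GCD using (gcd; GCD; gcd-GCD; GCD-*; gcd[m,n]∣n)
open import Data.Nat.Coprimality using (Coprime; GCD≡1⇒coprime; coprime-divisor)
open import Data.List using ([]; _∷_)
open import Data.Product using (_×_; _,_; ∃; proj₁; proj₂)
open import Data.Sum using (_⊎_; inj₁; inj₂)
open import Relation.Nullary using (¬_; yes; no)
open import Relation.Binary.Definitions using (tri<; tri≈; tri>)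
open import Data.Empty using (⊥-elim)
open import Relation.Binary.Bundles using (Setoid)
open import Relation.Binary.PropositionalEquality using (_≡_)
import Relation.Binary.PropositionalEquality as ≡
import Relation.Binary.Reasoning.Setoid as SetoidReasoning
import Algebra.Properties.Ring as RingProperties
import Algebra.Properties.CommutativeSemigroup as CommutativeSemigroupProperties
import Algebra.Properties.Semiring.Exp as Exp
import Algebra.Properties.Semiring.Mult as Mult
import Algebra.Solver.Ring.NaturalCoefficients.Default as RingSolver
open import Data.Nat.Solver using (module +-*-Solver)

below-or-above : ∀ k j → j < k ⊎ ∃ λ i → j ≡ k ℕ.+ i
below-or-above k j with j ℕ.<? k
... | yes j<k = inj₁ j<k
... | no j≮k  = inj₂ (let (i , k+i≡j) = ℕₚ.m≤n⇒∃[o]m+o≡n (ℕₚ.≮⇒≥ j≮k) in i , ≡.sym k+i≡j)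

open CommutativeSemigroupProperties ℕₚ.+-commutativeSemigroup using () renaming (x∙yz≈y∙xz to ℕ+-left-comm)

[k+i]/k≡1+i/k : ∀ k .{{_ : NonZero k}} i → (k ℕ.+ i) / k ≡ suc (i / k)
[k+i]/k≡1+i/k k i = ≡.trans (m/n≡1+[m∸n]/n (ℕₚ.m≤m+n k i)) (≡.cong (λ n → suc (n / k)) (ℕₚ.m+n∸m≡n k i))

module RingFacts {c ℓ : Level} (R : CommutativeRing c ℓ) where
  open CommutativeRing R
  open RingProperties ring using (-1*x≈-x; x∙y⁻¹≈ε⇒x≈y; [y-z]x≈yx-zx)
  open Exp semiring using (_^_; ^-congˡ; ^-homo-*; ^-assocʳ)
  open Mult semiring using (×-homo-+) renaming (_×_ to _·_)
  open RingSolver commutativeSemiring using (solve; _:=_; _:+_; _:*_)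
  open SetoidReasoning setoid

  pow≡^ : ∀ x n → pow R x n ≡ x ^ n
  pow≡^ x zero    = ≡.refl
  pow≡^ x (suc n) = ≡.cong (x *_) (pow≡^ x n)

  natCast≡× : ∀ n → natCast R n ≡ n · 1#
  natCast≡× zero    = ≡.refl
  natCast≡× (suc n) = ≡.cong (1# +_) (natCast≡× n)

  pow-cong : ∀ n {x y} → x ≈ y → pow R x n ≈ pow R y n
  pow-cong n {x} {y} rewrite pow≡^ x n | pow≡^ y n = ^-congˡ n

  pow-+ : ∀ x m n → pow R x (m ℕ.+ n) ≈ pow R x m * pow R x n
  pow-+ x m n rewrite pow≡^ x (m ℕ.+ n) | pow≡^ x m | pow≡^ x n = ^-homo-* x m n

  pow-pow : ∀ x m n → pow R (pow R x m) n ≈ pow R x (m ℕ.* n)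
  pow-pow x m n rewrite pow≡^ (pow R x m) n | pow≡^ x m | pow≡^ x (m ℕ.* n) = ^-assocʳ x m n

  pow-1# : ∀ n → pow R 1# n ≈ 1#
  pow-1# zero    = refl
  pow-1# (suc n) = trans (*-identityˡ _) (pow-1# n)

  natCast-+ : ∀ m n → natCast R (m ℕ.+ n) ≈ natCast R m + natCast R n
  natCast-+ m n rewrite natCast≡× (m ℕ.+ n) | natCast≡× m | natCast≡× n = ×-homo-+ 1# m n

  signPow-suc : ∀ n → signPow R (suc n) ≈ - signPow R n
  signPow-suc n = -1*x≈-x (signPow R n)

  pow-multiple : ∀ ζ n → pow R ζ n ≈ 1# → ∀ q → pow R ζ (n ℕ.* q) ≈ 1#
  pow-multiple ζ n ζⁿ≈1 q = trans (sym (pow-pow ζ n q)) (trans (pow-cong q ζⁿ≈1) (pow-1# q))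

  x+y*0≈x : ∀ x y → x + y * 0# ≈ x
  x+y*0≈x x y = trans (+-congˡ (zeroʳ y)) (+-identityʳ x)

  binomial-exchange : ∀ f A B C x y →
    (f + y * A) + x * (B + y * C) ≈ (f + x * B) + y * (A + x * C)
  binomial-exchange = solve 6 (λ f A B C x y →
    (f :+ y :* A) :+ x :* (B :+ y :* C) := (f :+ x :* B) :+ y :* (A :+ x :* C)) refl

  fixed⇒zero : IsIntegralDomain R → ∀ {x h} → ¬ (x ≈ 1#) → x * h ≈ h → h ≈ 0#
  fixed⇒zero (_ , noZeroDivisors) {x} {h} x≉1 xh≈h with noZeroDivisors (x - 1#) h [x-1]h≈0
    where
    [x-1]h≈0 : (x - 1#) * h ≈ 0#
    [x-1]h≈0 = begin
      (x - 1#) * h     ≈⟨ [y-z]x≈yx-zx h x 1# ⟩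
      x * h - 1# * h   ≈⟨ +-cong xh≈h (-‿cong (*-identityˡ h)) ⟩
      h - h            ≈⟨ -‿inverseʳ h ⟩
      0#               ∎
  ... | inj₁ x-1≈0 = ⊥-elim (x≉1 (x∙y⁻¹≈ε⇒x≈y x 1# x-1≈0))
  ... | inj₂ h≈0   = h≈0

module RootsOfUnity {c ℓ : Level} (R : CommutativeRing c ℓ) where
  open CommutativeRing R
  open RingFacts R

  order-divides : ∀ {ζ m} .{{_ : NonZero m}} → IsPrimitiveRoot R ζ m → ∀ n → pow R ζ n ≈ 1# → m ∣ n
  order-divides {ζ} {m} (ζᵐ≈1 , minimal) n ζⁿ≈1 with n % m ℕ.≟ 0
  ... | yes r≡0 = m%n≡0⇒n∣m n m r≡0
  ... | no r≢0  = ⊥-elim (minimal (n % m) (ℕₚ.n≢0⇒n>0 r≢0) (m%n<n n m) ζʳ≈1)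
    where
    open SetoidReasoning setoid
    ζʳ≈1 : pow R ζ (n % m) ≈ 1#
    ζʳ≈1 = begin
      pow R ζ (n % m)                                   ≈⟨ *-identityʳ _ ⟨
      pow R ζ (n % m) * 1#                              ≈⟨ *-congˡ (pow-multiple ζ m ζᵐ≈1 (n / m)) ⟨
      pow R ζ (n % m) * pow R ζ (m ℕ.* (n / m))         ≈⟨ pow-+ ζ (n % m) (m ℕ.* (n / m)) ⟨
      pow R ζ (n % m ℕ.+ m ℕ.* (n / m))                 ≡⟨ ≡.cong (pow R ζ) (≡.sym division) ⟩
      pow R ζ n                                         ≈⟨ ζⁿ≈1 ⟩
      1#                                                ∎
      where
      division : n ≡ n % m ℕ.+ m ℕ.* (n / m)
      division = ≡.trans (m≡m%n+[m/n]*n n m) (≡.cong (n % m ℕ.+_) (ℕₚ.*-comm (n / m) m))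

  power-primitive : ∀ {lam} α β u .{{_ : NonZero α}} .{{_ : NonZero β}} →
    IsPrimitiveRoot R lam (α ℕ.* β) → β ≡ gcd (α ℕ.* β) u → IsPrimitiveRoot R (pow R lam u) α
  power-primitive {lam} α β u prim β≡gcd = ζ^α≈1 , minimal
    where
    open +-*-Solver using (solve; _:*_; _:=_)
    instance
      αβ≢0 : NonZero (α ℕ.* β)
      αβ≢0 = ℕₚ.m*n≢0 α β

    u′ : ℕ
    u′ = u / β

    u≡u′β : u ≡ u′ ℕ.* β
    u≡u′β = ≡.sym (m/n*n≡m (≡.subst (_∣ u) (≡.sym β≡gcd) (gcd[m,n]∣n (α ℕ.* β) u)))

    coprime : Coprime α u′
    coprime = GCD≡1⇒coprime (GCD-* {c = β} (≡.subst₂ (λ x y → GCD (α ℕ.* β) x y) u≡u′β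
      (≡.trans (≡.sym β≡gcd) (≡.sym (ℕₚ.*-identityˡ β))) (gcd-GCD (α ℕ.* β) u)))

    ζ^α≈1 : pow R (pow R lam u) α ≈ 1#
    ζ^α≈1 = trans (pow-pow lam u α) (≡.subst (λ n → pow R lam n ≈ 1#) (≡.sym uα≡αβu′) (pow-multiple lam (α ℕ.* β) (proj₁ prim) u′))
      where
      uα≡αβu′ : u ℕ.* α ≡ α ℕ.* β ℕ.* u′
      uα≡αβu′ = ≡.trans (≡.cong (ℕ._* α) u≡u′β) (solve 3 (λ u′ α β → u′ :* β :* α := α :* β :* u′) ≡.refl u′ α β)

    minimal : ∀ k → 0 < k → k < α → ¬ (pow R (pow R lam u) k ≈ 1#)
    minimal k@(suc _) _ k<α ζᵏ≈1 = ℕₚ.<⇒≱ k<α (∣⇒≤ (coprime-divisor coprime (*-cancelʳ-∣ β αβ∣u′kβ)))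
      where
      αβ∣u′kβ : α ℕ.* β ∣ u′ ℕ.* k ℕ.* β
      αβ∣u′kβ = ≡.subst (α ℕ.* β ∣_) (≡.trans (≡.cong (ℕ._* k) u≡u′β)
                    (solve 3 (λ u′ β k → u′ :* β :* k := u′ :* k :* β) ≡.refl u′ β k))
                  (order-divides prim (u ℕ.* k) (trans (sym (pow-pow lam u k)) ζᵏ≈1))

-- Polynomials in z as coefficient sequences ℕ → R, compared pointwise, and
-- the operators on them used to build F_m.
module Sequences {c ℓ : Level} (R : CommutativeRing c ℓ) where
  open CommutativeRing R
  open RingFacts R
  open RingSolver commutativeSemiring using (solve; _:=_; _:+_; _:*_)

  Seq : Set c
  Seq = ℕ → Carrier

  infix 4 _≐_
  _≐_ : Seq → Seq → Set ℓ
  f ≐ g = ∀ j → f j ≈ g j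

  ≐-setoid : Setoid c ℓ
  ≐-setoid = record
    { Carrier       = Seq
    ; _≈_           = _≐_
    ; isEquivalence = record
      { refl  = λ _ → refl
      ; sym   = λ f≐g j → sym (f≐g j)
      ; trans = λ f≐g g≐h j → trans (f≐g j) (g≐h j)
      }
    }

  open Setoid ≐-setoid public using () renaming (refl to ≐-refl; sym to ≐-sym; trans to ≐-trans; reflexive to ≐-reflexive)
  module ≐-Reasoning = SetoidReasoning ≐-setoid

  unit : Seq
  unit = coeff R (1# ∷ [])

  shift : ℕ → Seq → Seq
  shift zero    f j       = f j
  shift (suc k) f zero    = 0#
  shift (suc k) f (suc j) = shift k f j

  shift-cong : ∀ k {f g} → f ≐ g → shift k f ≐ shift k g
  shift-cong zero    f≐g j       = f≐g j
  shift-cong (suc k) f≐g zero    = refl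
  shift-cong (suc k) f≐g (suc j) = shift-cong k f≐g j

  shift-linear : ∀ k f g x j → shift k (λ i → f i + x * g i) j ≈ shift k f j + x * shift k g j
  shift-linear zero    f g x j       = refl
  shift-linear (suc k) f g x zero    = sym (x+y*0≈x 0# x)
  shift-linear (suc k) f g x (suc j) = shift-linear k f g x j

  shift-shift : ∀ k l f j → shift k (shift l f) j ≡ shift (k ℕ.+ l) f j
  shift-shift zero    l f j       = ≡.refl
  shift-shift (suc k) l f zero    = ≡.refl
  shift-shift (suc k) l f (suc j) = shift-shift k l f j

  shift-below : ∀ k f j → j < k → shift k f j ≡ 0#
  shift-below (suc k) f zero    _         = ≡.refl
  shift-below (suc k) f (suc j) (s≤s j<k) = shift-below k f j j<k

  shift-above : ∀ k f i → shift k f (k ℕ.+ i) ≡ f i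
  shift-above zero    f i = ≡.refl
  shift-above (suc k) f i = shift-above k f i

  shift-unit-on : ∀ k → shift k unit k ≡ 1#
  shift-unit-on zero    = ≡.refl
  shift-unit-on (suc k) = shift-unit-on k

  shift-unit-off : ∀ k j → ¬ (j ≡ k) → shift k unit j ≡ 0#
  shift-unit-off zero    zero    j≢k = ⊥-elim (j≢k ≡.refl)
  shift-unit-off zero    (suc j) j≢k = ≡.refl
  shift-unit-off (suc k) zero    j≢k = ≡.refl
  shift-unit-off (suc k) (suc j) j≢k = shift-unit-off k j (λ j≡k → j≢k (≡.cong suc j≡k))

  mulBinomial : Carrier → ℕ → Seq → Seq
  mulBinomial c k f j = f j + c * shift k f j

  mulBinomial-cong : ∀ {c d} k {f g} → c ≈ d → f ≐ g → mulBinomial c k f ≐ mulBinomial d k g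
  mulBinomial-cong k c≈d f≐g j = +-cong (f≐g j) (*-cong c≈d (shift-cong k f≐g j))

  mulBinomial-comm : ∀ x k y l f →
    mulBinomial x k (mulBinomial y l f) ≐ mulBinomial y l (mulBinomial x k f)
  mulBinomial-comm x k y l f j = begin
    (f j + y * shift l f j) + x * shift k (mulBinomial y l f) j
      ≈⟨ +-congˡ (*-congˡ (shift-linear k f (shift l f) y j)) ⟩
    (f j + y * shift l f j) + x * (shift k f j + y * shift k (shift l f) j)
      ≡⟨ ≡.cong (λ t → (f j + y * shift l f j) + x * (shift k f j + y * t)) shifts-commute ⟩
    (f j + y * shift l f j) + x * (shift k f j + y * shift l (shift k f) j)
      ≈⟨ binomial-exchange (f j) (shift l f j) (shift k f j) (shift l (shift k f) j) x y ⟩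
    (f j + x * shift k f j) + y * (shift l f j + x * shift l (shift k f) j)
      ≈⟨ +-congˡ (*-congˡ (shift-linear l f (shift k f) x j)) ⟨
    (f j + x * shift k f j) + y * shift l (mulBinomial x k f) j ∎
    where
    open SetoidReasoning setoid
    shifts-commute : shift k (shift l f) j ≡ shift l (shift k f) j
    shifts-commute = ≡.trans (shift-shift k l f j)
      (≡.trans (≡.cong (λ n → shift n f j) (ℕₚ.+-comm k l)) (≡.sym (shift-shift l k f j)))

  binomialPower : Carrier → ℕ → ℕ → Seq → Seq
  binomialPower c k zero    f = f
  binomialPower c k (suc b) f = mulBinomial c k (binomialPower c k b f)

  coeff-mulLin : ∀ x p → coeff R (mulLin R 1# x p) ≐ mulBinomial x 1 (coeff R p)
  coeff-mulLin x []            zero          = sym (x+y*0≈x 0# x)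
  coeff-mulLin x []            (suc j)       = sym (x+y*0≈x 0# x)
  coeff-mulLin x (a ∷ p)       zero          = trans (*-identityˡ a) (sym (x+y*0≈x a x))
  coeff-mulLin x (a ∷ [])      (suc zero)    = sym (+-identityˡ (x * a))
  coeff-mulLin x (a ∷ [])      (suc (suc j)) = sym (x+y*0≈x 0# x)
  coeff-mulLin x (a ∷ b ∷ p)   (suc zero)    = +-congʳ (*-identityˡ b)
  coeff-mulLin x (a ∷ b ∷ p)   (suc (suc j)) = coeff-mulLin x (b ∷ p) (suc j)

  dilate : Carrier → Seq → Seq
  dilate ζ f j = pow R ζ j * f j

  dilate-mulBinomial : ∀ ζ x f → dilate ζ (mulBinomial x 1 f) ≐ mulBinomial (ζ * x) 1 (dilate ζ f)
  dilate-mulBinomial ζ x f zero    = trans (*-congˡ (x+y*0≈x (f 0) x)) (sym (x+y*0≈x _ (ζ * x)))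
  dilate-mulBinomial ζ x f (suc j) = solve 5 (λ ζ p x f₀ f₁ →
    (ζ :* p) :* (f₁ :+ x :* f₀) := (ζ :* p) :* f₁ :+ (ζ :* x) :* (p :* f₀)) refl
    ζ (pow R ζ j) x (f j) (f (suc j))

  dilate-unit : ∀ ζ → dilate ζ unit ≐ unit
  dilate-unit ζ zero    = *-identityˡ 1#
  dilate-unit ζ (suc j) = zeroʳ (pow R ζ (suc j))

module LinearProducts {c ℓ : Level} (R : CommutativeRing c ℓ) (ζ : CommutativeRing.Carrier R) where
  open CommutativeRing R
  open RingFacts R
  open Sequences R

  linProd : ℕ → ℕ → Seq → Seq
  linProd k zero    f = f
  linProd k (suc n) f = mulBinomial (pow R ζ k) 1 (linProd (suc k) n f)

  coeff-prodFrom : ∀ k n → coeff R (prodFrom R 1# ζ k n) ≐ linProd k n unit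
  coeff-prodFrom k zero    = ≐-refl
  coeff-prodFrom k (suc n) = ≐-trans (coeff-mulLin (pow R ζ k) (prodFrom R 1# ζ (suc k) n))
                                     (mulBinomial-cong 1 refl (coeff-prodFrom (suc k) n))

  linProd-cong : ∀ k n {f g} → f ≐ g → linProd k n f ≐ linProd k n g
  linProd-cong k zero    f≐g = f≐g
  linProd-cong k (suc n) f≐g = mulBinomial-cong 1 refl (linProd-cong (suc k) n f≐g)

  linProd-split : ∀ k x y f → linProd k (x ℕ.+ y) f ≐ linProd k x (linProd (k ℕ.+ x) y f)
  linProd-split k zero    y f = ≐-reflexive (≡.cong (λ i → linProd i y f) (≡.sym (ℕₚ.+-identityʳ k)))
  linProd-split k (suc x) y f = mulBinomial-cong 1 refl (≐-trans (linProd-split (suc k) x y f)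
    (≐-reflexive (≡.cong (λ i → linProd (suc k) x (linProd i y f)) (≡.sym (ℕₚ.+-suc k x)))))

  linProd-mulBinomial : ∀ k n x l f → linProd k n (mulBinomial x l f) ≐ mulBinomial x l (linProd k n f)
  linProd-mulBinomial k zero    x l f = ≐-refl
  linProd-mulBinomial k (suc n) x l f = ≐-trans (mulBinomial-cong 1 refl (linProd-mulBinomial (suc k) n x l f))
                                                (mulBinomial-comm (pow R ζ k) 1 x l _)

  linProd-binomialPower : ∀ k n x l b f → linProd k n (binomialPower x l b f) ≐ binomialPower x l b (linProd k n f)
  linProd-binomialPower k n x l zero    f = ≐-refl
  linProd-binomialPower k n x l (suc b) f = ≐-trans (linProd-mulBinomial k n x l _)
                                                    (mulBinomial-cong l refl (linProd-binomialPower k n x l b f))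

  pow-periodic : ∀ {p} → pow R ζ p ≈ 1# → ∀ k → pow R ζ (k ℕ.+ p) ≈ pow R ζ k
  pow-periodic {p} ζᵖ≈1 k = trans (pow-+ ζ k p) (trans (*-congˡ ζᵖ≈1) (*-identityʳ _))

  linProd-period : ∀ {p} → pow R ζ p ≈ 1# → ∀ k n f → linProd (k ℕ.+ p) n f ≐ linProd k n f
  linProd-period ζᵖ≈1 k zero    f = ≐-refl
  linProd-period ζᵖ≈1 k (suc n) f = mulBinomial-cong 1 (pow-periodic ζᵖ≈1 k) (linProd-period ζᵖ≈1 (suc k) n f)

  linProd-rotate : ∀ {n} → pow R ζ n ≈ 1# → ∀ k f → linProd (suc k) n f ≐ linProd k n f
  linProd-rotate {zero}  _    k f = ≐-refl
  linProd-rotate {suc n} ζⁿ≈1 k f = begin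
    linProd (suc k) (suc n) f
      ≡⟨ ≡.cong (λ i → linProd (suc k) i f) (ℕₚ.+-comm 1 n) ⟩
    linProd (suc k) (n ℕ.+ 1) f
      ≈⟨ linProd-split (suc k) n 1 f ⟩
    linProd (suc k) n (mulBinomial (pow R ζ (suc k ℕ.+ n)) 1 f)
      ≈⟨ linProd-cong (suc k) n (mulBinomial-cong 1 last-factor ≐-refl) ⟩
    linProd (suc k) n (mulBinomial (pow R ζ k) 1 f)
      ≈⟨ linProd-mulBinomial (suc k) n (pow R ζ k) 1 f ⟩
    linProd k (suc n) f ∎
    where
    open ≐-Reasoning
    last-factor : pow R ζ (suc k ℕ.+ n) ≈ pow R ζ k
    last-factor = trans (reflexive (≡.cong (pow R ζ) (≡.sym (ℕₚ.+-suc k n)))) (pow-periodic ζⁿ≈1 k)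

  linProd-dilate : ∀ k n f → linProd (suc k) n (dilate ζ f) ≐ dilate ζ (linProd k n f)
  linProd-dilate k zero    f = ≐-refl
  linProd-dilate k (suc n) f = ≐-trans (mulBinomial-cong 1 refl (linProd-dilate (suc k) n f))
                                       (≐-sym (dilate-mulBinomial ζ (pow R ζ k) _))

  linProd-unit-constant : ∀ k n → linProd k n unit 0 ≈ 1#
  linProd-unit-constant k zero    = refl
  linProd-unit-constant k (suc n) = trans (x+y*0≈x _ _) (linProd-unit-constant (suc k) n)

  linProd-unit-degree : ∀ k n j → n < j → linProd k n unit j ≈ 0#
  linProd-unit-degree k zero    (suc j) _         = refl
  linProd-unit-degree k (suc n) (suc j) (s≤s n<j) =
    trans (+-cong (linProd-unit-degree (suc k) n (suc j) (ℕₚ.m<n⇒m<1+n n<j))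
                  (*-congˡ (linProd-unit-degree (suc k) n j n<j)))
          (x+y*0≈x 0# _)

module GeometricSeries {c ℓ : Level} (R : CommutativeRing c ℓ) where
  open CommutativeRing R
  open RingFacts R
  open Sequences R
  open RingProperties ring using (-‿distribˡ-*; -‿involutive)
  open CommutativeSemigroupProperties *-commutativeSemigroup using () renaming (x∙yz≈y∙xz to *-left-comm)
  open SetoidReasoning setoid

  IsGeometric : ℕ → Seq → Set ℓ
  IsGeometric α g = (∀ j → j < α → g j ≈ signPow R j) × (∀ j → α ≤ j → g j ≈ 0#)

  -- The coefficient s_α = -(-1)^α, so that 1 + s_α z^α = 1 - (-z)^α.
  closingSign : ℕ → Carrier
  closingSign α = - signPow R α

  closingSign-signPow : ∀ α n → closingSign α * signPow R n ≈ signPow R (suc (α ℕ.+ n))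
  closingSign-signPow α n = begin
    (- signPow R α) * signPow R n   ≈⟨ -‿distribˡ-* (signPow R α) (signPow R n) ⟨
    - (signPow R α * signPow R n)   ≈⟨ -‿cong (pow-+ (- 1#) α n) ⟨
    - signPow R (α ℕ.+ n)           ≈⟨ signPow-suc (α ℕ.+ n) ⟨
    signPow R (suc (α ℕ.+ n))       ∎

  geometric-telescope : ∀ a {g} → IsGeometric (suc a) g →
    mulBinomial 1# 1 g ≐ mulBinomial (closingSign (suc a)) (suc a) unit
  geometric-telescope a {g} (low , high) zero = begin
    g 0 + 1# * 0#                          ≈⟨ x+y*0≈x _ 1# ⟩
    g 0                                    ≈⟨ low 0 (s≤s z≤n) ⟩
    1#                                     ≈⟨ x+y*0≈x 1# _ ⟨
    1# + closingSign (suc a) * 0#          ∎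
  geometric-telescope a {g} (low , high) (suc j) with ℕₚ.<-cmp j a
  ... | tri< j<a _ _ = begin
    g (suc j) + 1# * g j                           ≈⟨ +-cong (low (suc j) (s≤s j<a)) (*-identityˡ (g j)) ⟩
    signPow R (suc j) + g j                        ≈⟨ +-cong (signPow-suc j) (low j (ℕₚ.m<n⇒m<1+n j<a)) ⟩
    - signPow R j + signPow R j                    ≈⟨ -‿inverseˡ (signPow R j) ⟩
    0#                                             ≈⟨ x+y*0≈x 0# _ ⟨
    0# + closingSign (suc a) * 0#                  ≡⟨ ≡.cong (λ t → 0# + closingSign (suc a) * t)
                                                        (≡.sym (shift-unit-off a j (λ j≡a → ℕₚ.<-irrefl j≡a j<a))) ⟩
    0# + closingSign (suc a) * shift a unit j      ∎
  ... | tri≈ _ ≡.refl _ = begin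
    g (suc j) + 1# * g j                           ≈⟨ +-cong (high (suc j) ℕₚ.≤-refl) (*-identityˡ (g j)) ⟩
    0# + g j                                       ≈⟨ +-identityˡ (g j) ⟩
    g j                                            ≈⟨ low j (ℕₚ.n<1+n j) ⟩
    signPow R j                                    ≈⟨ -‿involutive (signPow R j) ⟨
    - (- signPow R j)                              ≈⟨ -‿cong (signPow-suc j) ⟨
    closingSign (suc j)                            ≈⟨ *-identityʳ _ ⟨
    closingSign (suc j) * 1#                       ≈⟨ +-identityˡ _ ⟨
    0# + closingSign (suc j) * 1#                  ≡⟨ ≡.cong (λ t → 0# + closingSign (suc j) * t) (≡.sym (shift-unit-on j)) ⟩
    0# + closingSign (suc j) * shift j unit j      ∎
  ... | tri> _ _ a<j = begin
    g (suc j) + 1# * g j                           ≈⟨ +-cong (high (suc j) (s≤s (ℕₚ.<⇒≤ a<j))) (*-congˡ (high j a<j)) ⟩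
    0# + 1# * 0#                                   ≈⟨ x+y*0≈x 0# 1# ⟩
    0#                                             ≈⟨ x+y*0≈x 0# _ ⟨
    0# + closingSign (suc a) * 0#                  ≡⟨ ≡.cong (λ t → 0# + closingSign (suc a) * t)
                                                        (≡.sym (shift-unit-off a j (λ j≡a → ℕₚ.<-irrefl (≡.sym j≡a) a<j))) ⟩
    0# + closingSign (suc a) * shift a unit j      ∎

  binomialPower-below : ∀ x k b f j → j < k → binomialPower x k b f j ≈ f j
  binomialPower-below x k zero    f j j<k = refl
  binomialPower-below x k (suc b) f j j<k = begin
    binomialPower x k b f j + x * shift k (binomialPower x k b f) j
      ≡⟨ ≡.cong (λ t → binomialPower x k b f j + x * t) (shift-below k _ j j<k) ⟩
    binomialPower x k b f j + x * 0#      ≈⟨ x+y*0≈x _ x ⟩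
    binomialPower x k b f j               ≈⟨ binomialPower-below x k b f j j<k ⟩
    f j                                   ∎

  binomialPower-geometric : ∀ α .{{_ : NonZero α}} {g} → IsGeometric α g → ∀ b j →
    binomialPower (closingSign α) α b g j ≈ natCast R (b C (j / α)) * signPow R (j / α ℕ.+ j)
  binomialPower-geometric α {g} (low , high) b j with below-or-above α j
  ... | inj₁ j<α rewrite m<n⇒m/n≡0 j<α = begin
    binomialPower (closingSign α) α b g j   ≈⟨ binomialPower-below (closingSign α) α b g j j<α ⟩
    g j                                     ≈⟨ low j j<α ⟩
    signPow R j                             ≈⟨ *-identityˡ _ ⟨
    1# * signPow R j                        ≈⟨ *-congʳ (+-identityʳ 1#) ⟨
    natCast R (b C 0) * signPow R j         ∎
  ... | inj₂ (i , ≡.refl) rewrite [k+i]/k≡1+i/k α i = above b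
    where
    q : ℕ
    q = i / α

    ε : Carrier
    ε = signPow R (suc q ℕ.+ (α ℕ.+ i))

    closingSign-step : closingSign α * signPow R (q ℕ.+ i) ≈ ε
    closingSign-step = trans (closingSign-signPow α (q ℕ.+ i))
      (reflexive (≡.cong (λ n → signPow R (suc n)) (ℕ+-left-comm α q i)))

    above : ∀ b → binomialPower (closingSign α) α b g (α ℕ.+ i) ≈ natCast R (b C suc q) * ε
    above zero = trans (high (α ℕ.+ i) (ℕₚ.m≤m+n α i)) (sym (zeroˡ ε))
    above (suc b) = begin
      P (α ℕ.+ i) + closingSign α * shift α P (α ℕ.+ i)
        ≡⟨ ≡.cong (λ t → P (α ℕ.+ i) + closingSign α * t) (shift-above α P i) ⟩
      P (α ℕ.+ i) + closingSign α * P i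
        ≈⟨ +-cong (above b) (*-congˡ (binomialPower-geometric α (low , high) b i)) ⟩
      natCast R (b C suc q) * ε + closingSign α * (natCast R (b C q) * signPow R (q ℕ.+ i))
        ≈⟨ +-congˡ (trans (*-left-comm _ _ _) (*-congˡ closingSign-step)) ⟩
      natCast R (b C suc q) * ε + natCast R (b C q) * ε
        ≈⟨ trans (+-comm _ _) (sym (distribʳ ε _ _)) ⟩
      (natCast R (b C q) + natCast R (b C suc q)) * ε
        ≈⟨ *-congʳ (natCast-+ (b C q) (b C suc q)) ⟨
      natCast R (b C q ℕ.+ b C suc q) * ε
        ≡⟨ ≡.cong (λ n → natCast R n * ε) (nCk+nC[k+1]≡[n+1]C[k+1] b q) ⟩
      natCast R (suc b C suc q) * ε ∎
      where
      P : Seq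
      P = binomialPower (closingSign α) α b g

module PrimitiveRootProducts {c ℓ : Level} (R : CommutativeRing c ℓ) (domain : IsIntegralDomain R)
    (ζ : CommutativeRing.Carrier R) (a : ℕ) (ζ-primitive : IsPrimitiveRoot R ζ (suc a)) where
  open CommutativeRing R
  open RingFacts R
  open Sequences R
  open LinearProducts R ζ
  open GeometricSeries R
  open RingProperties ring using (+-inverseˡ-unique)

  α : ℕ
  α = suc a

  ζ^α≈1 : pow R ζ α ≈ 1#
  ζ^α≈1 = proj₁ ζ-primitive

  cycle cofactor : Seq
  cycle    = linProd 0 α unit
  cofactor = linProd 1 a unit

  -- z ↦ ζ z permutes the factors of the cycle.
  cycle-dilation-invariant : dilate ζ cycle ≐ cycle
  cycle-dilation-invariant = begin
    dilate ζ (linProd 0 α unit)   ≈⟨ linProd-dilate 0 α unit ⟨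
    linProd 1 α (dilate ζ unit)   ≈⟨ linProd-cong 1 α (dilate-unit ζ) ⟩
    linProd 1 α unit              ≈⟨ linProd-rotate {α} ζ^α≈1 0 unit ⟩
    linProd 0 α unit              ∎
    where open ≐-Reasoning

  -- Hence ζ^j c_j = c_j, which forces c_j = 0 for 0 < j < α.
  cycle-middle : ∀ j → 0 < j → j < α → cycle j ≈ 0#
  cycle-middle j 0<j j<α = fixed⇒zero domain (proj₂ ζ-primitive j 0<j j<α) (cycle-dilation-invariant j)

  -- Since cycle = (1 + z) cofactor has vanishing middle coefficients, the
  -- cofactor (constant term 1, degree a) alternates in sign below z^α.
  cofactor-geometric : IsGeometric α cofactor
  cofactor-geometric = low , λ j a<j → linProd-unit-degree 1 a j a<j
    where
    low : ∀ j → j < α → cofactor j ≈ signPow R j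
    low zero    _         = linProd-unit-constant 1 a
    low (suc j) j+1<α = begin
      cofactor (suc j)            ≈⟨ +-inverseˡ-unique _ _ (cycle-middle (suc j) (s≤s z≤n) j+1<α) ⟩
      - (1# * cofactor j)         ≈⟨ -‿cong (*-identityˡ _) ⟩
      - cofactor j                ≈⟨ -‿cong (low j (ℕₚ.<-trans (ℕₚ.n<1+n j) j+1<α)) ⟩
      - signPow R j               ≈⟨ signPow-suc j ⟨
      signPow R (suc j)           ∎
      where open SetoidReasoning setoid

  cycle-binomial : cycle ≐ mulBinomial (closingSign α) α unit
  cycle-binomial = geometric-telescope a cofactor-geometric

  cycles : ∀ b → linProd 0 (α ℕ.* b) unit ≐ binomialPower (closingSign α) α b unit
  cycles zero    = ≐-reflexive (≡.cong (λ n → linProd 0 n unit) (ℕₚ.*-zeroʳ α))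
  cycles (suc b) = begin
    linProd 0 (α ℕ.* suc b) unit
      ≡⟨ ≡.cong (λ n → linProd 0 n unit) (≡.trans (ℕₚ.*-suc α b) (ℕₚ.+-comm α (α ℕ.* b))) ⟩
    linProd 0 (α ℕ.* b ℕ.+ α) unit
      ≈⟨ linProd-split 0 (α ℕ.* b) α unit ⟩
    linProd 0 (α ℕ.* b) (linProd (α ℕ.* b) α unit)
      ≈⟨ linProd-cong 0 (α ℕ.* b) (linProd-period ζ^αb≈1 0 α unit) ⟩
    linProd 0 (α ℕ.* b) cycle
      ≈⟨ linProd-cong 0 (α ℕ.* b) cycle-binomial ⟩
    linProd 0 (α ℕ.* b) (mulBinomial (closingSign α) α unit)
      ≈⟨ linProd-mulBinomial 0 (α ℕ.* b) (closingSign α) α unit ⟩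
    mulBinomial (closingSign α) α (linProd 0 (α ℕ.* b) unit)
      ≈⟨ mulBinomial-cong α refl (cycles b) ⟩
    binomialPower (closingSign α) α (suc b) unit ∎
    where
    open ≐-Reasoning
    ζ^αb≈1 : pow R ζ (α ℕ.* b) ≈ 1#
    ζ^αb≈1 = pow-multiple ζ α ζ^α≈1 b

  product-coefficients : ∀ b n → n ≡ a ℕ.+ α ℕ.* b → ∀ j →
    coeff R (prodFrom R 1# ζ 1 n) j ≈ natCast R (b C (j / α)) * signPow R (j / α ℕ.+ j)
  product-coefficients b n ≡.refl j = trans (factorisation j) (binomialPower-geometric α cofactor-geometric b j)
    where
    open ≐-Reasoning
    factorisation : coeff R (prodFrom R 1# ζ 1 (a ℕ.+ α ℕ.* b)) ≐ binomialPower (closingSign α) α b cofactor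
    factorisation = begin
      coeff R (prodFrom R 1# ζ 1 (a ℕ.+ α ℕ.* b))        ≈⟨ coeff-prodFrom 1 (a ℕ.+ α ℕ.* b) ⟩
      linProd 1 (a ℕ.+ α ℕ.* b) unit                      ≈⟨ linProd-split 1 a (α ℕ.* b) unit ⟩
      linProd 1 a (linProd α (α ℕ.* b) unit)              ≈⟨ linProd-cong 1 a (linProd-period ζ^α≈1 0 (α ℕ.* b) unit) ⟩
      linProd 1 a (linProd 0 (α ℕ.* b) unit)              ≈⟨ linProd-cong 1 a (cycles b) ⟩
      linProd 1 a (binomialPower (closingSign α) α b unit) ≈⟨ linProd-binomialPower 1 a (closingSign α) α b unit ⟩
      binomialPower (closingSign α) α b cofactor           ∎

-- The arithmetic of the statement (opened only here: above, _+_ and _*_ are the ring's).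
open import Data.Nat using (_+_; _*_; _∸_)

proposition6 : {c ℓ : Level} (R : CommutativeRing c ℓ) → IsIntegralDomain R →
    (lam : CommutativeRing.Carrier R) → (m u : ℕ) → 0 < m → 0 < u →
    IsPrimitiveRoot R lam m →
    (α β : ℕ) → .{{_ : NonZero α}} → β ≡ gcd m u → α * β ≡ m →
    (j : ℕ) →
    CommutativeRing._≈_ R
      (coeff R (F R m (CommutativeRing.1# R) (pow R lam u)) j)
      (CommutativeRing._*_ R (natCast R ((β ∸ 1) C (j / α))) (signPow R (j / α + j)))
-- β = 0 would force m = 0; otherwise this is product-coefficients for ζ = λ^u.
proposition6 R domain lam .(α * zero) u 0<m _ prim α zero _ ≡.refl j =
  ⊥-elim (ℕₚ.<-irrefl (≡.sym (ℕₚ.*-zeroʳ α)) 0<m)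
proposition6 R domain lam .(suc a * suc b) u _ _ prim (suc a) (suc b) β≡gcd ≡.refl j =
  product-coefficients b (suc a * suc b ∸ 1) m∸1≡a+αb j
  where
  open PrimitiveRootProducts R domain (pow R lam u) a (RootsOfUnity.power-primitive R (suc a) (suc b) u prim β≡gcd)
  m∸1≡a+αb : suc a * suc b ∸ 1 ≡ a + suc a * b
  m∸1≡a+αb = +-*-Solver.solve 2 (λ a b → b :+ a :* (con 1 :+ b) := a :+ (con 1 :+ a) :* b) ≡.refl a b
    where open +-*-Solver using (_:+_; _:*_; _:=_; con)
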